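{- $\mathbf{PF}^\omega$ is a conservative extension of $\mathbf{S}$: for every $\mathcal L_{\mathsf p}$-formula $A$, $\mathbf{PF}^\omega\vdash A$ iff $\mathbf{S}\vdash A$.
   Context: $\mathcal L_{\mathsf p}$ is the unimodal propositional language with modal operator $\Box_{\mathsf p}$; $\mathcal L_{\mathsf{pf}}$ adds a second operator $\Box_{\mathsf f}$ ($\Diamond=\neg\Box\neg$). $\mathbf{GL}$ has axioms: propositional tautologies, $\Box_{\mathsf p}(A\to B)\to(\Box_{\mathsf p}A\to\Box_{\mathsf p}B)$, $\Box_{\mathsf p}(\Box_{\mathsf p}A\to A)\to\Box_{\mathsf p}A$; rules modus ponens and $\Box_{\mathsf p}$-necessitation. $\mathbf{S}$ has as axioms all theorems of $\mathbf{GL}$ and all $\Box_{\mathsf p}A\to A$, with modus ponens as sole rule. $\mathbf{PF}$ (in $\mathcal L_{\mathsf{pf}}$) has axioms: propositional tautologies; the $\mathbf{GL}$ axioms; $\Box_{\mathsf f}(A\to B)\to(\Box_{\mathsf f}A\to\Box_{\mathsf f}B)$; $\Box_{\mathsf f}A\to A$; $\Box_{\mathsf f}A\to\Box_{\mathsf f}\Box_{\mathsf f}A$; $\Diamond_{\mathsf f}\Box_{\mathsf f}A\to\Box_{\mathsf f}\Diamond_{\mathsf f}A$; $\Box_{\mathsf p}A\to\Box_{\mathsf f}\Box_{\mathsf p}A$; $\Diamond_{\mathsf p}A\to\Box_{\mathsf f}\Diamond_{\mathsf p}A$; $\Box_{\mathsf p}A\to\Box_{\mathsf p}\Box_{\mathsf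 f}A$; rules modus ponens and necessitation for $\Box_{\mathsf p}$ and $\Box_{\mathsf f}$. $\mathbf{PF}^\omega$ has as axioms all theorems of $\mathbf{PF}$ and all $\Box_{\mathsf p}A\to\Box_{\mathsf f}A$, with modus ponens as sole rule. -}

module Defs where

open import Data.Nat using (ℕ)
open import Data.Bool using (Bool; true; false; _∨_; not)
open import Relation.Binary.PropositionalEquality using (_≡_)

data Fm : Set where
  var  : ℕ → Fm
  ⊥'   : Fm
  _⇒_  : Fm → Fm → Fm
  □p   : Fm → Fm
  □f   : Fm → Fm

infixr 5 _⇒_

¬' : Fm → Fm
¬' A = A ⇒ ⊥'

◇p : Fm → Fm
◇p A = ¬' (□p (¬' A))

◇f : Fm → Fm
◇f A = ¬' (□f (¬' A))

data IsLp : Fm → Set where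
  var  : ∀ n → IsLp (var n)
  ⊥'   : IsLp ⊥'
  _⇒_  : ∀ {A B} → IsLp A → IsLp B → IsLp (A ⇒ B)
  □p   : ∀ {A} → IsLp A → IsLp (□p A)

-- Propositional tautology: true under every boolean valuation in which
-- variables and boxed formulas are treated as propositional atoms.
eval : (Fm → Bool) → Fm → Bool
eval v (var n) = v (var n)
eval v ⊥' = false
eval v (A ⇒ B) = not (eval v A) ∨ eval v B
eval v (□p A) = v (□p A)
eval v (□f A) = v (□f A)

Taut : Fm → Set
Taut A = ∀ (v : Fm → Bool) → eval v A ≡ true

-- GL, in the language L_p: every axiom instance is required to be an
-- L_p-formula (rules then preserve L_p-ness).
data GL⊢_ : Fm → Set where
  taut : ∀ {A} → IsLp A → Taut A → GL⊢ A
  K    : ∀ A B → IsLp A → IsLp B → GL⊢ (□p (A ⇒ B) ⇒ (□p A ⇒ □p B))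
  Löb  : ∀ A → IsLp A → GL⊢ (□p (□p A ⇒ A) ⇒ □p A)
  mp   : ∀ {A B} → GL⊢ (A ⇒ B) → GL⊢ A → GL⊢ B
  nec  : ∀ {A} → GL⊢ A → GL⊢ (□p A)

data S⊢_ : Fm → Set where
  gl   : ∀ {A} → GL⊢ A → S⊢ A
  refl : ∀ A → IsLp A → S⊢ (□p A ⇒ A)
  mp   : ∀ {A B} → S⊢ (A ⇒ B) → S⊢ A → S⊢ B

data PF⊢_ : Fm → Set where
  taut  : ∀ {A} → Taut A → PF⊢ A
  Kp    : ∀ A B → PF⊢ (□p (A ⇒ B) ⇒ (□p A ⇒ □p B))
  Löb   : ∀ A → PF⊢ (□p (□p A ⇒ A) ⇒ □p A)
  Kf    : ∀ A B → PF⊢ (□f (A ⇒ B) ⇒ (□f A ⇒ □f B))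
  Tf    : ∀ A → PF⊢ (□f A ⇒ A)
  4f    : ∀ A → PF⊢ (□f A ⇒ □f (□f A))
  ax2f  : ∀ A → PF⊢ (◇f (□f A) ⇒ □f (◇f A))
  p□f   : ∀ A → PF⊢ (□p A ⇒ □f (□p A))
  p◇f   : ∀ A → PF⊢ (◇p A ⇒ □f (◇p A))
  pf    : ∀ A → PF⊢ (□p A ⇒ □p (□f A))
  mp    : ∀ {A B} → PF⊢ (A ⇒ B) → PF⊢ A → PF⊢ B
  necp  : ∀ {A} → PF⊢ A → PF⊢ (□p A)
  necf  : ∀ {A} → PF⊢ A → PF⊢ (□f A)

data PFω⊢_ : Fm → Set where
  pf   : ∀ {A} → PF⊢ A → PFω⊢ A
  pω   : ∀ A → PFω⊢ (□p A ⇒ □f A)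
  mp   : ∀ {A B} → PFω⊢ (A ⇒ B) → PFω⊢ A → PFω⊢ B

{-# OPTIONS --safe #-}
-- Erasing □f (reading it as the identity) sends PF into GL and PF^ω into S:
-- every □f-axiom of PF collapses to an instance of A → A, □f-necessitation
-- disappears, and □p A → □f A becomes the reflection axiom □p A → A of S.
-- Conversely S ⊆ PF^ω, since □p A → A follows from □p A → □f A and □f A → A.
-- As erasure fixes L_p-formulas, the two inclusions give conservativity.
module Submission where

open import Defs
open import Data.Bool using (Bool; true; false; _∨_; not)
open import Data.Bool.Properties using (∨-inverseˡ; ∨-zeroʳ)
open import Data.Product using (_×_; _,_)
open import Relation.Binary.PropositionalEquality
  using (_≡_; refl; sym; trans; cong; cong₂; subst)

erase : Fm → Fm
erase (var n) = var n
erase ⊥' = ⊥'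
erase (A ⇒ B) = erase A ⇒ erase B
erase (□p A) = □p (erase A)
erase (□f A) = erase A

isLp-erase : ∀ A → IsLp (erase A)
isLp-erase (var n) = var n
isLp-erase ⊥' = ⊥'
isLp-erase (A ⇒ B) = isLp-erase A ⇒ isLp-erase B
isLp-erase (□p A) = □p (isLp-erase A)
isLp-erase (□f A) = isLp-erase A

erase-isLp : ∀ {A} → IsLp A → erase A ≡ A
erase-isLp (var n) = refl
erase-isLp ⊥' = refl
erase-isLp (a ⇒ b) = cong₂ _⇒_ (erase-isLp a) (erase-isLp b)
erase-isLp (□p a) = cong □p (erase-isLp a)

-- An atom □f B is given the value of the whole formula erase B, so that this
-- valuation sees A exactly as v sees erase A.
pullbackValuation : (Fm → Bool) → Fm → Bool
pullbackValuation v (var n) = v (var n)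
pullbackValuation v ⊥' = v ⊥'
pullbackValuation v (A ⇒ B) = v (A ⇒ B)
pullbackValuation v (□p A) = v (□p (erase A))
pullbackValuation v (□f A) = eval v (erase A)

eval-pullbackValuation : ∀ v A → eval (pullbackValuation v) A ≡ eval v (erase A)
eval-pullbackValuation v (var n) = refl
eval-pullbackValuation v ⊥' = refl
eval-pullbackValuation v (A ⇒ B) =
  cong₂ (λ a b → not a ∨ b) (eval-pullbackValuation v A) (eval-pullbackValuation v B)
eval-pullbackValuation v (□p A) = refl
eval-pullbackValuation v (□f A) = refl

taut-erase : ∀ {A} → Taut A → Taut (erase A)
taut-erase {A} taut-A v =
  trans (sym (eval-pullbackValuation v A)) (taut-A (pullbackValuation v))

taut-⇒-refl : ∀ A → Taut (A ⇒ A)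
taut-⇒-refl A v = ∨-inverseˡ (eval v A)

implies-trans-true : ∀ x y z →
  not (not x ∨ y) ∨ (not (not y ∨ z) ∨ (not x ∨ z)) ≡ true
implies-trans-true true true z = ∨-inverseˡ z
implies-trans-true true false z = refl
implies-trans-true false y z = ∨-zeroʳ (not (not y ∨ z))

taut-⇒-trans : ∀ A B C → Taut ((A ⇒ B) ⇒ (B ⇒ C) ⇒ (A ⇒ C))
taut-⇒-trans A B C v = implies-trans-true (eval v A) (eval v B) (eval v C)

GL-⇒-refl : ∀ {A} → IsLp A → GL⊢ (A ⇒ A)
GL-⇒-refl {A} a = taut (a ⇒ a) (taut-⇒-refl A)

GL-⇒-refl-erase : ∀ A → GL⊢ (erase A ⇒ erase A)
GL-⇒-refl-erase A = GL-⇒-refl (isLp-erase A)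

PF⊢-erase : ∀ {A} → PF⊢ A → GL⊢ erase A
PF⊢-erase (taut {A} taut-A) = taut (isLp-erase A) (taut-erase {A} taut-A)
PF⊢-erase (Kp A B) = K (erase A) (erase B) (isLp-erase A) (isLp-erase B)
PF⊢-erase (Löb A) = Löb (erase A) (isLp-erase A)
PF⊢-erase (Kf A B) = GL-⇒-refl-erase (A ⇒ B)
PF⊢-erase (Tf A) = GL-⇒-refl-erase A
PF⊢-erase (4f A) = GL-⇒-refl-erase A
PF⊢-erase (ax2f A) = GL-⇒-refl-erase (◇f (□f A))
PF⊢-erase (p□f A) = GL-⇒-refl-erase (□p A)
PF⊢-erase (p◇f A) = GL-⇒-refl-erase (◇p A)
PF⊢-erase (pf A) = GL-⇒-refl-erase (□p A)
PF⊢-erase (mp d e) = mp (PF⊢-erase d) (PF⊢-erase e)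
PF⊢-erase (necp d) = nec (PF⊢-erase d)
PF⊢-erase (necf d) = PF⊢-erase d

PFω⊢-erase : ∀ {A} → PFω⊢ A → S⊢ erase A
PFω⊢-erase (pf d) = gl (PF⊢-erase d)
PFω⊢-erase (pω A) = refl (erase A) (isLp-erase A)
PFω⊢-erase (mp d e) = mp (PFω⊢-erase d) (PFω⊢-erase e)

GL⊢⇒PF⊢ : ∀ {A} → GL⊢ A → PF⊢ A
GL⊢⇒PF⊢ (taut _ taut-A) = taut taut-A
GL⊢⇒PF⊢ (K A B _ _) = Kp A B
GL⊢⇒PF⊢ (Löb A _) = Löb A
GL⊢⇒PF⊢ (mp d e) = mp (GL⊢⇒PF⊢ d) (GL⊢⇒PF⊢ e)
GL⊢⇒PF⊢ (nec d) = necp (GL⊢⇒PF⊢ d)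

PFω-⇒-trans : ∀ {A B C} → PFω⊢ (A ⇒ B) → PFω⊢ (B ⇒ C) → PFω⊢ (A ⇒ C)
PFω-⇒-trans {A} {B} {C} d e = mp (mp (pf (taut (taut-⇒-trans A B C))) d) e

S⊢⇒PFω⊢ : ∀ {A} → S⊢ A → PFω⊢ A
S⊢⇒PFω⊢ (gl d) = pf (GL⊢⇒PF⊢ d)
S⊢⇒PFω⊢ (refl A _) = PFω-⇒-trans (pω A) (pf (Tf A))
S⊢⇒PFω⊢ (mp d e) = mp (S⊢⇒PFω⊢ d) (S⊢⇒PFω⊢ e)

corollaryA4 : ∀ (A : Fm) → IsLp A → ((PFω⊢ A → S⊢ A) × (S⊢ A → PFω⊢ A))
corollaryA4 A a = (λ d → subst S⊢_ (erase-isLp a) (PFω⊢-erase d)) , S⊢⇒PFω⊢
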